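{- For every integer $m\ge 1$, the directed multigraph ${\cal D}^*_m$ is disconnected, and each of its connected components is strongly connected.
   Context: Alpha-letters (2-element subsets of the directions up, down, left, right): $a=\{\text{right},\text{down}\}$, $b=\{\text{up},\text{down}\}$, $c=\{\text{right},\text{up}\}$, $d=\{\text{left},\text{down}\}$, $e=\{\text{left},\text{right}\}$, $f=\{\text{left},\text{up}\}$. ${\cal D}_{ud}$: arc $(\alpha,\beta)$ iff ($\text{down}\in\alpha\iff\text{up}\in\beta$); ${\cal D}_{lr}$: arc $(\alpha,\beta)$ iff ($\text{right}\in\alpha\iff\text{left}\in\beta$). ${\cal D}_m$: vertices are the words $\alpha_1\cdots\alpha_m\in\{a,\dots,f\}^m$ with $(\alpha_i,\alpha_{i+1})$ an arc of ${\cal D}_{ud}$ for $1\le i\le m$ ($\alpha_{m+1}:=\alpha_1$); arc $v\to u$ iff $(v_i,u_i)$ is an arc of ${\cal D}_{lr}$ for all $i$. Outlet word $o(\alpha)\in\{0,1\}^m$: $o_j=1$ iff $\alpha_j\in\{a,c,e\}$; inlet word $i(\alpha)$: $i_j=1$ iff $\alpha_j\in\{d,e,f\}$. ${\cal D}^*_m$ is obtained from ${\cal D}_m$ by merging vertices with a common outlet word: vertex set $\{o(x):x\in V({\cal D}_m)\}$, and the number of arcs from $v$ to $w$ equals $|\{y\in V({\cal D}_m): i(y)=v,\ o(y)=w\}|$. Connected components are those of the underlying undirected multigraph. -}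

module Defs where

open import Data.Nat using (ℕ; suc; NonZero)
open import Data.Nat.DivMod using (_%_; m%n<n)
open import Data.Fin using (Fin; toℕ; fromℕ<)
open import Data.Bool using (Bool; true; false)
open import Data.Vec using (Vec; lookup; map)
open import Data.Product using (Σ; _×_)
open import Relation.Binary.PropositionalEquality using (_≡_)
open import Relation.Binary.Construct.Closure.ReflexiveTransitive using (Star)
open import Relation.Binary.Construct.Closure.Symmetric using (SymClosure)

-- The six alpha-letters.
-- a = {right,down}, b = {up,down}, c = {right,up},
-- d = {left,down},  e = {left,right}, f = {left,up}
data Letter : Set where
  a b c d e f : Letter

hasUp hasDown hasLeft hasRight : Letter → Bool
hasUp a = false
hasUp b = true
hasUp c = true
hasUp d = false
hasUp e = false
hasUp f = true

hasDown a = true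
hasDown b = true
hasDown c = false
hasDown d = true
hasDown e = false
hasDown f = false

hasLeft a = false
hasLeft b = false
hasLeft c = false
hasLeft d = true
hasLeft e = true
hasLeft f = true

hasRight a = true
hasRight b = false
hasRight c = true
hasRight d = false
hasRight e = true
hasRight f = false

UDArc : Letter → Letter → Set
UDArc α β = hasDown α ≡ hasUp β

LRArc : Letter → Letter → Set
LRArc α β = hasRight α ≡ hasLeft β

next : ∀ {m} → Fin m → Fin m
next {suc n} i = fromℕ< (m%n<n (suc (toℕ i)) (suc n))

IsVertex : (m : ℕ) → Vec Letter m → Set
IsVertex m w = (i : Fin m) → UDArc (lookup w i) (lookup w (next i))

-- outlet word: 1 iff letter ∈ {a,c,e} (i.e. contains right)
outletL : Letter → Bool
outletL a = true
outletL b = false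
outletL c = true
outletL d = false
outletL e = true
outletL f = false

-- inlet word: 1 iff letter ∈ {d,e,f} (i.e. contains left)
inletL : Letter → Bool
inletL a = false
inletL b = false
inletL c = false
inletL d = true
inletL e = true
inletL f = true

outlet : ∀ {m} → Vec Letter m → Vec Bool m
outlet = map outletL

inlet : ∀ {m} → Vec Letter m → Vec Bool m
inlet = map inletL

VStar : (m : ℕ) → Vec Bool m → Set
VStar m v = Σ (Vec Letter m) λ x → IsVertex m x × outlet x ≡ v

-- there is at least one arc from v to w in D*_m (both endpoints vertices of D*_m);
-- multiplicities are irrelevant for (strong) connectivity.
ArcStar : (m : ℕ) → Vec Bool m → Vec Bool m → Set
ArcStar m v w = VStar m v × VStar m w ×
  Σ (Vec Letter m) λ y → IsVertex m y × inlet y ≡ v × outlet y ≡ w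

Connected : (m : ℕ) → Vec Bool m → Vec Bool m → Set
Connected m = Star (SymClosure (ArcStar m))

Reachable : (m : ℕ) → Vec Bool m → Vec Bool m → Set
Reachable m = Star (ArcStar m)

-- The parity of the number of 1s of a word is an invariant of D*_m: a letter has exactly two
-- directions, so left ≡ right + up + down (mod 2), and summed over a vertex of D_m the vertical
-- contributions cancel, because down at position i matches up at position i + 1 cyclically.
-- Hence an arc y of D*_m joins words of equal parity, while both parities occur, e.g. as the
-- outlets of b⋯b and of f a b⋯b (or e when m = 1).  Exchanging left and right in every letter
-- turns an arc y from i(y) to o(y) into an arc from o(y) to i(y), so every component is strongly
-- connected.
module Submission where

open import Defs
open import Algebra.Bundles using (CommutativeMonoid; CommutativeRing)
open import Data.Bool using (Bool; true; false; _xor_)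
open import Data.Bool.Properties using (xor-∧-commutativeRing; xor-same; xor-identityʳ)
open import Data.Fin using (Fin; zero; suc; inject₁; fromℕ; toℕ)
open import Data.Fin.Properties using (toℕ-injective; toℕ-fromℕ<; toℕ-inject₁; toℕ-fromℕ; toℕ<n)
open import Data.Fin.Relation.Unary.Top using (view; ‵fromℕ; ‵inject₁)
open import Data.Nat using (ℕ; zero; suc; _≤_; _%_; s≤s)
open import Data.Nat.DivMod using (m<n⇒m%n≡m; n%n≡0)
open import Data.Product using (Σ; _×_; _,_)
open import Data.Vec using (Vec; []; _∷_; lookup; map; replicate)
open import Data.Vec.Functional using (Vector; init; last; head; tail)
open import Data.Vec.Properties using (lookup-map; lookup-replicate; map-∘; map-cong)
open import Function using (_∘_; id)
open import Level using (Level)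
open import Relation.Nullary using (¬_)
open import Relation.Binary.PropositionalEquality using (_≡_; refl; sym; trans; cong; cong₂; isEquivalence; module ≡-Reasoning)
open import Relation.Binary.Construct.Closure.Equivalence using (gfold)
open import Relation.Binary.Construct.Closure.ReflexiveTransitive as Star using ()
open import Relation.Binary.Construct.Closure.Symmetric as SymClosure using ()

next-inject₁ : ∀ {n} (j : Fin n) → next {suc n} (inject₁ j) ≡ suc j
next-inject₁ {n} j = toℕ-injective (begin
  toℕ (next (inject₁ j))        ≡⟨ toℕ-fromℕ< _ ⟩
  suc (toℕ (inject₁ j)) % suc n ≡⟨ cong (λ t → suc t % suc n) (toℕ-inject₁ j) ⟩
  suc (toℕ j) % suc n           ≡⟨ m<n⇒m%n≡m (s≤s (toℕ<n j)) ⟩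
  suc (toℕ j)                   ∎)
  where open ≡-Reasoning

next-fromℕ : ∀ n → next {suc n} (fromℕ n) ≡ zero
next-fromℕ n = toℕ-injective (begin
  toℕ (next (fromℕ n))        ≡⟨ toℕ-fromℕ< _ ⟩
  suc (toℕ (fromℕ n)) % suc n ≡⟨ cong (λ t → suc t % suc n) (toℕ-fromℕ n) ⟩
  suc n % suc n               ≡⟨ n%n≡0 (suc n) ⟩
  0                           ∎)
  where open ≡-Reasoning

module _ {ℓ₁ ℓ₂ : Level} (M : CommutativeMonoid ℓ₁ ℓ₂) where
  open CommutativeMonoid M
  open import Algebra.Properties.CommutativeMonoid.Sum M using (sum; sum-cong-≗; sum-init-last)
  open import Relation.Binary.Reasoning.Setoid setoid

  sum-∘-next : ∀ {n} (t : Vector Carrier (suc n)) → sum (t ∘ next) ≈ sum t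
  sum-∘-next {n} t = begin
    sum (t ∘ next)                          ≈⟨ sum-init-last (t ∘ next) ⟩
    sum (init (t ∘ next)) ∙ last (t ∘ next) ≡⟨ cong₂ _∙_ (sum-cong-≗ (cong t ∘ next-inject₁))
                                                         (cong t (next-fromℕ n)) ⟩
    sum (tail t) ∙ head t                   ≈⟨ comm _ _ ⟩
    sum t                                   ∎

open CommutativeRing xor-∧-commutativeRing using (+-commutativeMonoid)
open import Algebra.Properties.CommutativeMonoid.Sum +-commutativeMonoid
  using (sum; sum-cong-≗; ∑-distrib-+; sum-replicate-zero)

parity : ∀ {m} → Vec Bool m → Bool
parity w = sum (lookup w)

parity-map : ∀ {m} {A : Set} (g : A → Bool) (w : Vec A m) →
             parity (map g w) ≡ sum (g ∘ lookup w)
parity-map g w = sum-cong-≗ (λ i → lookup-map i g w)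

inletL≡outletL-xor-hasUp-xor-hasDown : ∀ α → inletL α ≡ outletL α xor (hasUp α xor hasDown α)
inletL≡outletL-xor-hasUp-xor-hasDown a = refl
inletL≡outletL-xor-hasUp-xor-hasDown b = refl
inletL≡outletL-xor-hasUp-xor-hasDown c = refl
inletL≡outletL-xor-hasUp-xor-hasDown d = refl
inletL≡outletL-xor-hasUp-xor-hasDown e = refl
inletL≡outletL-xor-hasUp-xor-hasDown f = refl

parity-inlet≡parity-outlet : ∀ {m} (y : Vec Letter m) → IsVertex m y → parity (inlet y) ≡ parity (outlet y)
parity-inlet≡parity-outlet {zero} _ _ = refl
parity-inlet≡parity-outlet {suc n} y isVertex = begin
  parity (inlet y)                                  ≡⟨ parity-map inletL y ⟩
  sum (inletL ∘ lookup y)                           ≡⟨ sum-cong-≗ (inletL≡outletL-xor-hasUp-xor-hasDown ∘ lookup y) ⟩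
  sum (λ i → out i xor (up i xor down i))           ≡⟨ ∑-distrib-+ out (λ i → up i xor down i) ⟩
  sum out xor sum (λ i → up i xor down i)           ≡⟨ cong (sum out xor_) (∑-distrib-+ up down) ⟩
  sum out xor (sum up xor sum down)                 ≡⟨ cong (λ s → sum out xor (sum up xor s)) down-shifts-up ⟩
  sum out xor (sum up xor sum up)                   ≡⟨ cong (sum out xor_) (xor-same (sum up)) ⟩
  sum out xor false                                 ≡⟨ xor-identityʳ (sum out) ⟩
  sum out                                           ≡⟨ parity-map outletL y ⟨
  parity (outlet y)                                 ∎
  where
  open ≡-Reasoning
  out up down : Vector Bool (suc n)
  out = outletL ∘ lookup y
  up = hasUp ∘ lookup y
  down = hasDown ∘ lookup y
  down-shifts-up : sum down ≡ sum up
  down-shifts-up = trans (sum-cong-≗ isVertex) (sum-∘-next +-commutativeMonoid up)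

arc-parity : ∀ {m} {v w} → ArcStar m v w → parity v ≡ parity w
arc-parity (_ , _ , y , isVertex , refl , refl) = parity-inlet≡parity-outlet y isVertex

connected⇒parity≡ : ∀ {m} {u v} → Connected m u v → parity u ≡ parity v
connected⇒parity≡ = gfold isEquivalence parity arc-parity

mirror : Letter → Letter
mirror a = d
mirror b = b
mirror c = f
mirror d = a
mirror e = e
mirror f = c

hasUp-mirror : ∀ α → hasUp (mirror α) ≡ hasUp α
hasUp-mirror a = refl
hasUp-mirror b = refl
hasUp-mirror c = refl
hasUp-mirror d = refl
hasUp-mirror e = refl
hasUp-mirror f = refl

hasDown-mirror : ∀ α → hasDown (mirror α) ≡ hasDown α
hasDown-mirror a = refl
hasDown-mirror b = refl
hasDown-mirror c = refl
hasDown-mirror d = refl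
hasDown-mirror e = refl
hasDown-mirror f = refl

inletL-mirror : ∀ α → inletL (mirror α) ≡ outletL α
inletL-mirror a = refl
inletL-mirror b = refl
inletL-mirror c = refl
inletL-mirror d = refl
inletL-mirror e = refl
inletL-mirror f = refl

outletL-mirror : ∀ α → outletL (mirror α) ≡ inletL α
outletL-mirror a = refl
outletL-mirror b = refl
outletL-mirror c = refl
outletL-mirror d = refl
outletL-mirror e = refl
outletL-mirror f = refl

isVertex-mirror : ∀ {m} (y : Vec Letter m) → IsVertex m y → IsVertex m (map mirror y)
isVertex-mirror y isVertex i = begin
  hasDown (lookup (map mirror y) i)        ≡⟨ cong hasDown (lookup-map i mirror y) ⟩
  hasDown (mirror (lookup y i))            ≡⟨ hasDown-mirror _ ⟩
  hasDown (lookup y i)                     ≡⟨ isVertex i ⟩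
  hasUp (lookup y (next i))                ≡⟨ hasUp-mirror _ ⟨
  hasUp (mirror (lookup y (next i)))       ≡⟨ cong hasUp (lookup-map (next i) mirror y) ⟨
  hasUp (lookup (map mirror y) (next i))   ∎
  where open ≡-Reasoning

ArcStar-symmetric : ∀ {m} {v w} → ArcStar m v w → ArcStar m w v
ArcStar-symmetric (vertex-v , vertex-w , y , isVertex , refl , refl) =
  vertex-w , vertex-v , map mirror y , isVertex-mirror y isVertex ,
  trans (sym (map-∘ inletL mirror y)) (map-cong inletL-mirror y) ,
  trans (sym (map-∘ outletL mirror y)) (map-cong outletL-mirror y)

connected⇒reachable : ∀ {m} {u v} → Connected m u v → Reachable m u v
connected⇒reachable = Star.map (SymClosure.fold ArcStar-symmetric id)

isVertex-replicate : ∀ m {α} → UDArc α α → IsVertex m (replicate m α)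
isVertex-replicate m {α} loop i = begin
  hasDown (lookup (replicate m α) i)        ≡⟨ cong hasDown (lookup-replicate i α) ⟩
  hasDown α                                 ≡⟨ loop ⟩
  hasUp α                                   ≡⟨ cong hasUp (lookup-replicate (next i) α) ⟨
  hasUp (lookup (replicate m α) (next i))   ∎
  where open ≡-Reasoning

isVertex-cyclic : ∀ {n} (y : Vec Letter (suc n)) →
                  (∀ j → UDArc (lookup y (inject₁ j)) (lookup y (suc j))) →
                  UDArc (lookup y (fromℕ n)) (lookup y zero) →
                  IsVertex (suc n) y
isVertex-cyclic {n} y steps wrap i with view i
... | ‵fromℕ     = trans wrap (cong (hasUp ∘ lookup y) (sym (next-fromℕ n)))
... | ‵inject₁ j = trans (steps j) (cong (hasUp ∘ lookup y) (sym (next-inject₁ j)))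

parity-outlet-replicate-b : ∀ m → parity (outlet (replicate m b)) ≡ false
parity-outlet-replicate-b m = begin
  parity (outlet (replicate m b))          ≡⟨ parity-map outletL (replicate m b) ⟩
  sum (outletL ∘ lookup (replicate m b))   ≡⟨ sum-cong-≗ {m} (λ i → cong outletL (lookup-replicate i b)) ⟩
  sum {m} (λ _ → false)                    ≡⟨ sum-replicate-zero m ⟩
  false                                    ∎
  where open ≡-Reasoning

oddVertex : ∀ n → Vec Letter (suc n)
oddVertex zero    = e ∷ []
oddVertex (suc k) = f ∷ a ∷ replicate k b

oddVertex-isVertex : ∀ n → IsVertex (suc n) (oddVertex n)
oddVertex-isVertex zero    zero = refl
oddVertex-isVertex (suc k) = isVertex-cyclic (oddVertex (suc k)) steps (hasDown-a∷bs (fromℕ k))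
  where
  hasDown-a∷bs : ∀ i → hasDown (lookup (a ∷ replicate k b) i) ≡ true
  hasDown-a∷bs zero    = refl
  hasDown-a∷bs (suc i) = cong hasDown (lookup-replicate i b)
  steps : ∀ j → UDArc (lookup (oddVertex (suc k)) (inject₁ j)) (lookup (oddVertex (suc k)) (suc j))
  steps zero    = refl
  steps (suc j) = trans (hasDown-a∷bs (inject₁ j)) (cong hasUp (sym (lookup-replicate j b)))

parity-outlet-oddVertex : ∀ n → parity (outlet (oddVertex n)) ≡ true
parity-outlet-oddVertex zero    = refl
parity-outlet-oddVertex (suc k) = cong (true xor_) (parity-outlet-replicate-b k)

theorem2 : (m : ℕ) → 1 ≤ m →
    (Σ (Vec Bool m) λ u → Σ (Vec Bool m) λ v → VStar m u × VStar m v × ¬ Connected m u v)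
    × ((u v : Vec Bool m) → VStar m u → VStar m v → Connected m u v → Reachable m u v)
theorem2 (suc n) _ =
  ( outlet (replicate (suc n) b) , outlet (oddVertex n)
  , (replicate (suc n) b , isVertex-replicate (suc n) refl , refl)
  , (oddVertex n , oddVertex-isVertex n , refl)
  , λ connected → false≢true (begin
      false                                 ≡⟨ parity-outlet-replicate-b (suc n) ⟨
      parity (outlet (replicate (suc n) b)) ≡⟨ connected⇒parity≡ connected ⟩
      parity (outlet (oddVertex n))         ≡⟨ parity-outlet-oddVertex n ⟩
      true                                  ∎))
  , λ _ _ _ _ → connected⇒reachable
  where
  open ≡-Reasoning
  false≢true : ¬ false ≡ true
  false≢true ()
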